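{- Let $\mathcal{C}\subseteq 2^{[n]}$ and $\mathcal{D}\subseteq 2^{[m]}$ be neural codes and let $f:\mathcal{C}\to\mathcal{D}$ be a morphism. If the codeword containment graph $G_\mathcal{C}$ is connected, then the codeword containment graph $G_{f(\mathcal{C})}$ of the code $f(\mathcal{C})=\{f(c)\mid c\in\mathcal{C}\}$ is connected.
   Context: A neural code on $n$ neurons is a collection of subsets of $[n]$. The codeword containment graph $G_\mathcal{C}$ of a code $\mathcal{C}$ is the undirected simple graph with vertex set $\mathcal{C}$ in which $\sigma,\tau$ are adjacent iff $\sigma\subsetneq\tau$ or $\tau\subsetneq\sigma$. For $\sigma\subseteq[n]$, the trunk of $\sigma$ in $\mathcal{C}$ is $\mathrm{Tk}_\mathcal{C}(\sigma)=\{c\in\mathcal{C}\mid \sigma\subseteq c\}$; a subset of $\mathcal{C}$ is a trunk in $\mathcal{C}$ if it is empty or equals $\mathrm{Tk}_\mathcal{C}(\sigma)$ for some $\sigma\subseteq[n]$. A function $f:\mathcal{C}\to\mathcal{D}$ between codes is a morphism if for every trunk $T\subseteq\mathcal{D}$ the preimage $f^{ -1}(T)$ is a trunk in $\mathcal{C}$. -}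

module Defs where

open import Data.Nat using (ℕ)
open import Data.Fin.Subset using (Subset; _⊆_; _⊂_)
open import Data.List using (List; map)
open import Data.List.Membership.Propositional using (_∈_)
open import Data.Product using (_×_; ∃-syntax)
open import Data.Sum using (_⊎_)
open import Relation.Nullary using (¬_)
open import Function.Bundles using (_⇔_)
open import Level using (0ℓ; suc)

-- A neural code on n neurons: a (finite) collection of subsets of [n].
-- Represented as a list of codewords; the code is the set of its members.
Code : ℕ → Set
Code n = List (Subset n)

Adj : ∀ {n} → Subset n → Subset n → Set
Adj σ τ = σ ⊂ τ ⊎ τ ⊂ σ

data Reach {n} (C : Code n) : Subset n → Subset n → Set where
  here : ∀ {σ} → Reach C σ σ
  step : ∀ {σ ρ τ} → ρ ∈ C → Adj σ ρ → Reach C ρ τ → Reach C σ τ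

Connected : ∀ {n} → Code n → Set
Connected C = ∀ {σ τ} → σ ∈ C → τ ∈ C → Reach C σ τ

-- Trunk of σ in C as a predicate on codewords: c ∈ Tk_C(σ) iff c ∈ C and σ ⊆ c.
-- A subset T of C (given as a predicate, only its values on C matter) is a
-- trunk in C if it is empty or equals Tk_C(σ) for some σ ⊆ [n].
IsTrunk : ∀ {n} → Code n → (Subset n → Set) → Set
IsTrunk {n} C T =
  (∀ c → c ∈ C → ¬ T c)
  ⊎ (∃[ σ ] (∀ c → c ∈ C → (T c ⇔ σ ⊆ c)))

-- f : C → D (a function on subsets; only its values on C are relevant)
-- is a morphism if preimages of trunks in D are trunks in C.
IsMorphism : ∀ {n m} → Code n → Code m → (Subset n → Subset m) → Set₁
IsMorphism C D f =
  (∀ c → c ∈ C → f c ∈ D)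
  × (∀ (T : Subset _ → Set) → IsTrunk D T → IsTrunk C (λ c → T (f c)))

image : ∀ {n m} → (Subset n → Subset m) → Code n → Code m
image f C = map f C

-- A morphism is monotone on C: the preimage of the trunk of f(c) is a trunk in
-- C containing c, hence is the trunk of some σ ⊆ c, and so contains every
-- codeword above c. Thus each edge σ ⊂ ρ of G_C maps to f(σ) ⊆ f(ρ), which is
-- an edge of G_{f(C)} or a loop, and every walk in G_C maps to a walk in
-- G_{f(C)}.
module Submission where

open import Defs
open import Data.Nat using (ℕ)
open import Data.Fin.Subset using (Subset; _⊆_; _⊂_; inside; outside)
open import Data.Fin.Subset.Properties
  using (drop-∷-⊆; out⊂in; s⊂s; ⊆-trans; ⊆-refl; p⊂q⇒p⊆q)
open import Data.Vec using ([]; _∷_; here)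
open import Data.List.Membership.Propositional using (_∈_)
open import Data.List.Membership.Propositional.Properties using (∈-map⁺; ∈-map⁻)
open import Data.Product using (_,_)
open import Data.Sum using (_⊎_; inj₁; inj₂)
open import Data.Empty using (⊥-elim)
open import Function.Base using (id)
open import Function.Bundles using (mk⇔; Equivalence)
open import Relation.Nullary using (contradiction)
open import Relation.Binary.PropositionalEquality using (_≡_; refl; cong; sym; subst)

⊆⇒≡⊎⊂ : ∀ {n} {p q : Subset n} → p ⊆ q → p ≡ q ⊎ p ⊂ q
⊆⇒≡⊎⊂ {p = []}          {[]}          _   = inj₁ refl
⊆⇒≡⊎⊂ {p = inside ∷ p}  {outside ∷ q} p⊆q = contradiction (p⊆q here) λ ()
⊆⇒≡⊎⊂ {p = outside ∷ p} {inside ∷ q}  p⊆q = inj₂ (out⊂in (drop-∷-⊆ p⊆q))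
⊆⇒≡⊎⊂ {p = inside ∷ p}  {inside ∷ q}  p⊆q with ⊆⇒≡⊎⊂ (drop-∷-⊆ p⊆q)
... | inj₁ p≡q = inj₁ (cong (inside ∷_) p≡q)
... | inj₂ p⊂q = inj₂ (s⊂s p⊂q)
⊆⇒≡⊎⊂ {p = outside ∷ p} {outside ∷ q} p⊆q with ⊆⇒≡⊎⊂ (drop-∷-⊆ p⊆q)
... | inj₁ p≡q = inj₁ (cong (outside ∷_) p≡q)
... | inj₂ p⊂q = inj₂ (s⊂s p⊂q)

Reach-comparable : ∀ {n} {C : Code n} {σ ρ τ} → ρ ∈ C → σ ⊆ ρ ⊎ ρ ⊆ σ →
                   Reach C ρ τ → Reach C σ τ
Reach-comparable {C = C} {τ = τ} ρ∈C (inj₁ σ⊆ρ) r with ⊆⇒≡⊎⊂ σ⊆ρ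
... | inj₁ σ≡ρ = subst (λ x → Reach C x τ) (sym σ≡ρ) r
... | inj₂ σ⊂ρ = step ρ∈C (inj₁ σ⊂ρ) r
Reach-comparable {C = C} {τ = τ} ρ∈C (inj₂ ρ⊆σ) r with ⊆⇒≡⊎⊂ ρ⊆σ
... | inj₁ ρ≡σ = subst (λ x → Reach C x τ) ρ≡σ r
... | inj₂ ρ⊂σ = step ρ∈C (inj₂ ρ⊂σ) r

MonotoneOn : ∀ {n m} → Code n → (Subset n → Subset m) → Set
MonotoneOn C f = ∀ {c c′} → c ∈ C → c′ ∈ C → c ⊆ c′ → f c ⊆ f c′

Reach-map : ∀ {n m} {C : Code n} {f : Subset n → Subset m} → MonotoneOn C f →
            ∀ {σ τ} → σ ∈ C → Reach C σ τ → Reach (image f C) (f σ) (f τ)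
Reach-map mono σ∈C here = here
Reach-map {f = f} mono {σ} σ∈C (step {ρ = ρ} ρ∈C adj r) =
  Reach-comparable (∈-map⁺ f ρ∈C) (comparable adj) (Reach-map mono ρ∈C r)
  where
  comparable : Adj σ ρ → f σ ⊆ f ρ ⊎ f ρ ⊆ f σ
  comparable (inj₁ σ⊂ρ) = inj₁ (mono σ∈C ρ∈C (p⊂q⇒p⊆q σ⊂ρ))
  comparable (inj₂ ρ⊂σ) = inj₂ (mono ρ∈C σ∈C (p⊂q⇒p⊆q ρ⊂σ))

morphism-monotone : ∀ {n m} {C : Code n} {D : Code m} {f : Subset n → Subset m} →
                    IsMorphism C D f → MonotoneOn C f
morphism-monotone {f = f} (_ , trunk-preimage) {c} {c′} c∈C c′∈C c⊆c′
  with trunk-preimage (f c ⊆_) (inj₂ (f c , λ _ _ → mk⇔ id id))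
... | inj₁ empty = ⊥-elim (empty c c∈C ⊆-refl)
... | inj₂ (_ , in-Tk-σ) =
  Equivalence.from (in-Tk-σ c′ c′∈C)
    (⊆-trans (Equivalence.to (in-Tk-σ c c∈C) ⊆-refl) c⊆c′)

mainTheorem2 : (n m : ℕ) (C : Code n) (D : Code m) (f : Subset n → Subset m) →
    IsMorphism C D f → Connected C → Connected (image f C)
mainTheorem2 n m C D f mor conn σ∈fC τ∈fC with ∈-map⁻ f σ∈fC | ∈-map⁻ f τ∈fC
... | c , c∈C , refl | c′ , c′∈C , refl =
  Reach-map (morphism-monotone mor) c∈C (conn c∈C c′∈C)
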